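{- Let $G$ be a graph with $\operatorname{pg}(G)=\gamma$. Let $P$ be a shortest path starting in a vertex $s$, let $Q$ be a subpath of $P$ with $|Q|>\gamma$ (number of vertices), let $u,w$ be vertices in $P\setminus Q$ with $d_G(s,u)<d_G(s,Q)<d_G(s,w)$, and let $x$ be any vertex of $G$. If $d_G(x,u)<d_G(x,Q)$, then $d_G(x,w)\ge d_G(x,Q)$.
   Context: Graphs are finite, connected, unweighted, undirected and simple; $d_G$ is shortest-path distance, $d_G(v,S)=\min_{u\in S}d_G(u,v)$, $\Pr(x,S)=\{u\in S\mid d_G(u,x)=d_G(x,S)\}$. Projection gap: for an integer $\gamma\ge0$, $G$ has projection gap at most $\gamma$ if for every shortest path $P=(v_0,\dots,v_l)$ (with $d_G(v_0,v_i)=i$), every vertex $x$ and every $v_i,v_k\in\Pr(x,P)$ with $i<k$, $d_G(v_i,v_k)>\gamma+1$ implies there is $v_j\in\Pr(x,P)$ with $i<j<k$; $\operatorname{pg}(G)$ is the least such $\gamma$. -}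

module Defs where

open import Data.Nat using (ℕ; zero; suc; _+_; _≤_; _<_; _∸_)
open import Data.Fin using (Fin; toℕ) renaming (zero to fzero; suc to fsuc)
import Data.Fin as F
open import Data.Product using (Σ; ∃; _×_; _,_)
open import Relation.Nullary using (¬_)
open import Relation.Binary.PropositionalEquality using (_≡_)

record Graph : Set₁ where
  field
    n         : ℕ
    Adj       : Fin n → Fin n → Set
    adj-sym   : ∀ {u v} → Adj u v → Adj v u
    adj-irr   : ∀ {u} → ¬ Adj u u
  V : Set
  V = Fin n

module _ (G : Graph) where
  open Graph G

  data Walk : V → V → ℕ → Set where
    nil  : ∀ {u} → Walk u u 0
    cons : ∀ {u v w k} → Adj u v → Walk v w k → Walk u w (suc k)

  Connected : Set
  Connected = ∀ u v → ∃ λ k → Walk u v k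

  IsDist : V → V → ℕ → Set
  IsDist u v k = Walk u v k × (∀ m → Walk u v m → k ≤ m)

  IsSetDist : V → (V → Set) → ℕ → Set
  IsSetDist x S k =
    (∃ λ y → S y × IsDist x y k) × (∀ y m → S y → IsDist x y m → k ≤ m)

  PathSet : ∀ {l} → (Fin (suc l) → V) → V → Set
  PathSet {l} P y = ∃ λ (i : Fin (suc l)) → P i ≡ y

  InPr : V → (V → Set) → V → Set
  InPr x S y = S y × (∀ k → IsSetDist x S k → IsDist x y k)

  IsShortestPath : ∀ {l} → (Fin (suc l) → V) → Set
  IsShortestPath {l} P =
    (∀ (i : Fin l) → Adj (P (F.inject₁ i)) (P (fsuc i)))
    × (∀ (i : Fin (suc l)) → IsDist (P fzero) (P i) (toℕ i))

  PGAtMost : ℕ → Set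
  PGAtMost γ =
    ∀ (l : ℕ) (P : Fin (suc l) → V) → IsShortestPath P →
    ∀ (x : V) (i k : Fin (suc l)) → i F.< k →
    InPr x (PathSet P) (P i) → InPr x (PathSet P) (P k) →
    ∀ D → IsDist (P i) (P k) D → suc γ < D →
    ∃ λ (j : Fin (suc l)) → i F.< j × j F.< k × InPr x (PathSet P) (P j)

  PG≡ : ℕ → Set
  PG≡ γ = PGAtMost γ × (∀ γ' → γ' < γ → ¬ PGAtMost γ')

  SubPathSet : ∀ {l} → (Fin (suc l) → V) → Fin (suc l) → Fin (suc l) → V → Set
  SubPathSet {l} P a b y = ∃ λ (j : Fin (suc l)) → a F.≤ j × j F.≤ b × P j ≡ y

-- Suppose d(x,w) < d(x,Q) and let c = max(d(x,u), d(x,w)) < d(x,Q). Along P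
-- the function t ↦ d(x, v_t) is 1-Lipschitz, is at most c at u (before Q) and
-- at w (after Q), and exceeds c on all of Q. Hence there are indices p before Q
-- and q after Q with d(x, v_p) = d(x, v_q) = c and d(x, v_t) > c strictly in
-- between. On the subpath v_p … v_q, whose length exceeds γ + 1, the two
-- endpoints are then the only projections of x, contradicting pg(G) ≤ γ.
-- Distances exist only under double negation, which suffices because the
-- conclusion is decidable.
module Submission where

open import Defs
open import Data.Nat using (ℕ; zero; suc; _+_; _∸_; _⊔_; _≤_; _<_; s≤s; z<s; _≤?_)
open import Data.Nat.Induction using (<-rec)
open import Data.Nat.Properties
open import Data.Fin using (Fin; toℕ) renaming (zero to fzero; suc to fsuc)
import Data.Fin as F
import Data.Fin.Properties as FP
open import Data.Product using (∃; ∃₂; _×_; _,_; proj₁; proj₂)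
open import Data.Sum using (inj₁; inj₂)
open import Data.Empty using (⊥)
open import Effect.Monad using (RawMonad)
open import Function using (_∘_)
open import Relation.Nullary using (¬_; yes; no)
open import Relation.Nullary.Decidable using (decidable-stable)
open import Relation.Nullary.Negation using (¬¬-Monad; contradiction)
open import Relation.Binary.PropositionalEquality
  using (_≡_; refl; sym; trans; cong; subst; subst₂)

¬¬-least : (Q : ℕ → Set) {k : ℕ} → Q k → ¬ ¬ (∃ λ m → Q m × (∀ j → Q j → m ≤ j))
¬¬-least Q {k} = <-rec (λ k → Q k → ¬ ¬ (∃ λ m → Q m × (∀ j → Q j → m ≤ j))) step k
  where
  step : ∀ k → (∀ {j} → j < k → Q j → ¬ ¬ (∃ λ m → Q m × (∀ j → Q j → m ≤ j))) →
         Q k → ¬ ¬ (∃ λ m → Q m × (∀ j → Q j → m ≤ j))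
  step k rec qk ¬least = ¬least (k , qk , λ j qj →
    decidable-stable (k ≤? j) λ k≰j → rec (≰⇒> k≰j) qj ¬least)

2+[n∸m]≤o∸k : ∀ {k m n o} → k < m → m ≤ n → n < o → suc (suc (n ∸ m)) ≤ o ∸ k
2+[n∸m]≤o∸k {k} {m} {n} {o} k<m m≤n n<o = begin
  suc (suc (n ∸ m)) ≤⟨ s≤s (∸-monoʳ-< k<m m≤n) ⟩
  suc (n ∸ k)       ≡⟨ sym (+-∸-assoc 1 (≤-trans (<⇒≤ k<m) m≤n)) ⟩
  suc n ∸ k         ≤⟨ ∸-monoˡ-≤ k n<o ⟩
  o ∸ k             ∎
  where open ≤-Reasoning

Lipschitz₁ : (ℕ → ℕ) → Set
Lipschitz₁ D = ∀ t → D (suc t) ≤ suc (D t) × D t ≤ suc (D (suc t))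

record Hump (D : ℕ → ℕ) (c p q : ℕ) : Set where
  field
    left  : D p ≡ c
    right : D q ≡ c
    above : ∀ t → p < t → t < q → c < D t

  floor : ∀ t → p ≤ t → t ≤ q → c ≤ D t
  floor t p≤t t≤q with m≤n⇒m<n∨m≡n p≤t | m≤n⇒m<n∨m≡n t≤q
  ... | inj₂ refl | _         = ≤-reflexive (sym left)
  ... | inj₁ _    | inj₂ refl = ≤-reflexive (sym right)
  ... | inj₁ p<t  | inj₁ t<q  = <⇒≤ (above t p<t t<q)

module _ {D : ℕ → ℕ} (lip : Lipschitz₁ D) {c : ℕ} where

  crossing-before : ∀ {i A} → i < A → D i ≤ c → c < D A →
    ∃ λ p → p < A × D p ≡ c × (∀ t → p < t → t ≤ A → c < D t)
  crossing-before {A = suc A} (s≤s i≤A) Di≤c c<DsA with D A ≤? c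
  ... | yes DA≤c =
    A , ≤-refl , ≤-antisym DA≤c (≤-pred (<-≤-trans c<DsA (proj₁ (lip A)))) , at-suc
    where
    at-suc : ∀ t → A < t → t ≤ suc A → c < D t
    at-suc t A<t t≤sA with ≤-antisym t≤sA A<t
    ... | refl = c<DsA
  ... | no DA≰c with crossing-before (≤∧≢⇒< i≤A λ { refl → DA≰c Di≤c }) Di≤c (≰⇒> DA≰c)
  ...   | p , p<A , Dp≡c , above = p , m<n⇒m<1+n p<A , Dp≡c , above′
    where
    above′ : ∀ t → p < t → t ≤ suc A → c < D t
    above′ t p<t t≤sA with m≤n⇒m<n∨m≡n t≤sA
    ... | inj₁ t<sA = above t p<t (≤-pred t<sA)
    ... | inj₂ refl = c<DsA

  -- Recursion upwards from B on k = j ∸ suc B: the crossing sought is the first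
  -- one after B.
  crossing-after : ∀ k {B} → D (k + suc B) ≤ c → c < D B →
    ∃ λ q → B < q × q ≤ k + suc B × D q ≡ c × (∀ t → B ≤ t → t < q → c < D t)
  crossing-after k {B} Dj≤c c<DB with D (suc B) ≤? c
  ... | yes DsB≤c =
    suc B , ≤-refl , m≤n+m (suc B) k ,
    ≤-antisym DsB≤c (≤-pred (<-≤-trans c<DB (proj₂ (lip B)))) , at-B
    where
    at-B : ∀ t → B ≤ t → t < suc B → c < D t
    at-B t B≤t t<sB with ≤-antisym (≤-pred t<sB) B≤t
    ... | refl = c<DB
  crossing-after zero    Dj≤c c<DB | no DsB≰c = contradiction Dj≤c DsB≰c
  crossing-after (suc k) {B} Dj≤c c<DB | no DsB≰c
    with crossing-after k (subst (λ t → D t ≤ c) (sym (+-suc k (suc B))) Dj≤c) (≰⇒> DsB≰c)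
  ... | q , sB<q , q≤j , Dq≡c , above =
    q , <-trans ≤-refl sB<q , subst (q ≤_) (+-suc k (suc B)) q≤j , Dq≡c , above′
    where
    above′ : ∀ t → B ≤ t → t < q → c < D t
    above′ t B≤t t<q with m≤n⇒m<n∨m≡n B≤t
    ... | inj₁ B<t = above t B<t t<q
    ... | inj₂ refl = c<DB

  hump-around : ∀ {i A B j} → i < A → A ≤ B → B < j → D i ≤ c → D j ≤ c →
    (∀ t → A ≤ t → t ≤ B → c < D t) →
    ∃₂ λ p q → p < A × B < q × q ≤ j × Hump D c p q
  hump-around {A = A} {B} {j} i<A A≤B B<j Di≤c Dj≤c far
    with crossing-before i<A Di≤c (far A ≤-refl A≤B)
       | crossing-after (j ∸ suc B) (subst (λ t → D t ≤ c) (sym (m∸n+n≡m B<j)) Dj≤c)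
           (far B A≤B ≤-refl)
  ... | p , p<A , Dp≡c , left-rise | q , B<q , q≤j , Dq≡c , right-rise =
    p , q , p<A , B<q , subst (q ≤_) (m∸n+n≡m B<j) q≤j ,
    record { left = Dp≡c ; right = Dq≡c ; above = above }
    where
    above : ∀ t → p < t → t < q → c < D t
    above t p<t t<q with t ≤? A | t ≤? B
    ... | yes t≤A | _       = left-rise t p<t t≤A
    ... | no t≰A  | yes t≤B = far t (<⇒≤ (≰⇒> t≰A)) t≤B
    ... | no _    | no t≰B  = right-rise t (<⇒≤ (≰⇒> t≰B)) t<q

module _ {G : Graph} where
  open Graph G

  _▷_ : ∀ {u v w k} → Walk G u v k → Adj v w → Walk G u w (suc k)
  nil      ▷ e = cons e nil
  cons e W ▷ f = cons e (W ▷ f)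

  _++ʷ_ : ∀ {u v w k m} → Walk G u v k → Walk G v w m → Walk G u w (k + m)
  nil      ++ʷ W′ = W′
  cons e W ++ʷ W′ = cons e (W ++ʷ W′)

  IsDist-unique : ∀ {x y k k′} → IsDist G x y k → IsDist G x y k′ → k ≡ k′
  IsDist-unique (W , min) (W′ , min′) = ≤-antisym (min _ W′) (min′ _ W)

  IsSetDist-unique : ∀ {x S k k′} → IsSetDist G x S k → IsSetDist G x S k′ → k ≡ k′
  IsSetDist-unique ((y , y∈S , dy) , min) ((y′ , y′∈S , dy′) , min′) =
    ≤-antisym (min y′ _ y′∈S dy′) (min′ y _ y∈S dy)

  ¬¬-IsDist : Connected G → ∀ x v → ¬ ¬ ∃ (IsDist G x v)
  ¬¬-IsDist conn x v ¬dist =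
    ¬¬-least (Walk G x v) (proj₂ (conn x v)) λ (k , W , min) → ¬dist (k , W , min)

  ¬¬-distances : Connected G → ∀ x → ¬ ¬ (∀ v → ∃ (IsDist G x v))
  ¬¬-distances conn x = FP.sequence (RawMonad.rawApplicative ¬¬-Monad) (¬¬-IsDist conn x)

  module Distances {x : V} {δ : V → ℕ} (δ-dist : ∀ v → IsDist G x v (δ v)) where

    δ-adj : ∀ {v w} → Adj v w → δ w ≤ suc (δ v)
    δ-adj {v} {w} e = proj₂ (δ-dist w) _ (proj₁ (δ-dist v) ▷ e)

    dist-to-path : ∀ {L c} {R : Fin (suc L) → V} → (∀ t → c ≤ δ (R t)) → δ (R fzero) ≡ c →
      IsSetDist G x (PathSet G R) c
    dist-to-path {R = R} floor first =
      (R fzero , (fzero , refl) , subst (IsDist G x (R fzero)) first (δ-dist _)) ,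
      λ { y m (t , refl) dy → subst (_ ≤_) (IsDist-unique (δ-dist y) dy) (floor t) }

    InPr-intro : ∀ {S c v} → IsSetDist G x S c → S v → δ v ≡ c → InPr G x S v
    InPr-intro dist-S v∈S δv≡c = v∈S , λ k dk →
      subst (IsDist G x _) (trans δv≡c (IsSetDist-unique dist-S dk)) (δ-dist _)

    InPr-dist : ∀ {S c v} → IsSetDist G x S c → InPr G x S v → δ v ≡ c
    InPr-dist {v = v} dist-S (_ , projection) = IsDist-unique (δ-dist v) (projection _ dist-S)

    inner-projection : ∀ {γ L c} {R : Fin (suc L) → V} → PGAtMost G γ →
      IsShortestPath G R → suc γ < L → (∀ t → c ≤ δ (R t)) →
      δ (R fzero) ≡ c → δ (R (F.fromℕ L)) ≡ c →
      ∃ λ j → 0 < toℕ j × toℕ j < L × δ (R j) ≡ c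
    inner-projection {γ} {L} {c} {R} pg sp long floor first last
      with pg L R sp x fzero (F.fromℕ L) (subst (0 <_) (sym L≡) (<-trans z<s long))
              (InPr-intro dist-R (fzero , refl) first) (InPr-intro dist-R (F.fromℕ L , refl) last)
              (toℕ (F.fromℕ L)) (proj₂ sp (F.fromℕ L)) (subst (suc γ <_) (sym L≡) long)
      where
      L≡ : toℕ (F.fromℕ L) ≡ L
      L≡ = FP.toℕ-fromℕ L
      dist-R : IsSetDist G x (PathSet G R) c
      dist-R = dist-to-path floor first
    ... | j , 0<j , j<L , j∈Pr =
      j , 0<j , subst (toℕ j <_) (FP.toℕ-fromℕ L) j<L , InPr-dist (dist-to-path floor first) j∈Pr

-- A path P = (v_0, …, v_l) is read as the sequence P ∘ clamp l on ℕ, which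
-- stalls at v_l after index l; indices then live in ℕ and t ↦ d(x, v_t) stays
-- 1-Lipschitz on all of ℕ.
clamp : (l : ℕ) → ℕ → Fin (suc l)
clamp l       zero    = fzero
clamp zero    (suc m) = fzero
clamp (suc l) (suc m) = fsuc (clamp l m)

toℕ-clamp : ∀ {l m} → m ≤ l → toℕ (clamp l m) ≡ m
toℕ-clamp {m = zero}  _         = refl
toℕ-clamp {m = suc m} (s≤s m≤l) = cong suc (toℕ-clamp m≤l)

clamp-toℕ : ∀ {l} (i : Fin (suc l)) → clamp l (toℕ i) ≡ i
clamp-toℕ fzero            = refl
clamp-toℕ {suc l} (fsuc i) = cong fsuc (clamp-toℕ i)

clamp-step : ∀ {l} m → m < l →
  ∃ λ (i : Fin l) → clamp l m ≡ F.inject₁ i × clamp l (suc m) ≡ fsuc i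
clamp-step {suc l} zero    _         = fzero , refl , refl
clamp-step {suc l} (suc m) (s≤s m<l) with clamp-step m m<l
... | i , e , e′ = fsuc i , cong fsuc e , cong fsuc e′

clamp-stall : ∀ {l} m → l ≤ m → clamp l (suc m) ≡ clamp l m
clamp-stall {zero}  zero    _         = refl
clamp-stall {zero}  (suc m) _         = refl
clamp-stall {suc l} (suc m) (s≤s l≤m) = cong fsuc (clamp-stall m l≤m)

module Along (G : Graph) {l : ℕ} {P : Fin (suc l) → Graph.V G} (sp : IsShortestPath G P) where
  open Graph G

  along : ℕ → V
  along = P ∘ clamp l

  along-toℕ : ∀ i → along (toℕ i) ≡ P i
  along-toℕ i = cong P (clamp-toℕ i)

  along-adj : ∀ m → m < l → Adj (along m) (along (suc m))
  along-adj m m<l with clamp-step m m<l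
  ... | i , e , e′ = subst₂ Adj (cong P (sym e)) (cong P (sym e′)) (proj₁ sp i)

  along-stall : ∀ m → l ≤ m → along (suc m) ≡ along m
  along-stall m l≤m = cong P (clamp-stall m l≤m)

  along-dist₀ : ∀ {m} → m ≤ l → IsDist G (P fzero) (along m) m
  along-dist₀ {m} m≤l = subst (IsDist G (P fzero) (along m)) (toℕ-clamp m≤l) (proj₂ sp (clamp l m))

  walk-along : ∀ t {p} → t + p ≤ l → Walk G (along p) (along (t + p)) t
  walk-along zero    _ = nil
  walk-along (suc t) {p} t+p<l = walk-along t (<⇒≤ t+p<l) ▷ along-adj (t + p) t+p<l

  -- The lower bound is the triangle inequality through v_0.
  along-dist : ∀ t {p} → t + p ≤ l → IsDist G (along p) (along (t + p)) t
  along-dist t {p} t+p≤l = walk-along t t+p≤l , λ k W →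
    +-cancelʳ-≤ p t k (subst (t + p ≤_) (+-comm p k)
      (proj₂ (along-dist₀ t+p≤l) (p + k) (proj₁ (along-dist₀ p≤l) ++ʷ W)))
    where
    p≤l : p ≤ l
    p≤l = ≤-trans (m≤n+m p t) t+p≤l

  segment : ∀ L → ℕ → Fin (suc L) → V
  segment L p t = along (toℕ t + p)

  segment-isShortestPath : ∀ {L p} → L + p ≤ l → IsShortestPath G (segment L p)
  segment-isShortestPath {L} {p} L+p≤l = adjacent , distance
    where
    adjacent : ∀ (i : Fin L) → Adj (segment L p (F.inject₁ i)) (segment L p (fsuc i))
    adjacent i = subst (λ t → Adj (along (t + p)) (along (suc (toℕ i) + p)))
      (sym (FP.toℕ-inject₁ i)) (along-adj (toℕ i + p) (≤-trans (+-monoˡ-< p (FP.toℕ<n i)) L+p≤l))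
    distance : ∀ (t : Fin (suc L)) → IsDist G (segment L p fzero) (segment L p t) (toℕ t)
    distance t = along-dist (toℕ t) (≤-trans (+-monoˡ-≤ p (≤-pred (FP.toℕ<n t))) L+p≤l)

  beyond-subpath : ∀ {a b j dQ} → IsSetDist G (P fzero) (SubPathSet G P a b) dQ →
    dQ < toℕ j → ¬ SubPathSet G P a b (P j) → toℕ b < toℕ j
  beyond-subpath ((_ , (i , a≤i , i≤b , refl) , di) , _) dQ<j j∉Q =
    ≰⇒> λ j≤b → j∉Q (_ , ≤-trans a≤i i≤j , j≤b , refl)
    where
    i≤j : toℕ i ≤ toℕ _
    i≤j = <⇒≤ (subst (_< _) (IsDist-unique di (proj₂ sp i)) dQ<j)

  module _ {x : V} {δ : V → ℕ} (δ-dist : ∀ v → IsDist G x v (δ v)) where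
    open Distances δ-dist

    along-lipschitz : Lipschitz₁ (δ ∘ along)
    along-lipschitz m with m <? l
    ... | yes m<l = δ-adj (along-adj m m<l) , δ-adj (adj-sym (along-adj m m<l))
    ... | no m≮l rewrite along-stall m (≮⇒≥ m≮l) = n≤1+n _ , n≤1+n _

    PGAtMost⇒¬long-hump : ∀ {γ c p q} → PGAtMost G γ → Hump (δ ∘ along) c p q →
      q ≤ l → suc γ < q ∸ p → ⊥
    PGAtMost⇒¬long-hump {γ} {c} {p} {q} pg hump q≤l long =
      refute (inner-projection pg (segment-isShortestPath (≤-trans (≤-reflexive L+p≡q) q≤l))
                long floor′ left (trans (cong (δ ∘ along) end≡q) right))
      where
      open Hump hump
      L+p≡q : q ∸ p + p ≡ q
      L+p≡q = m∸n+n≡m (<⇒≤ (m∸n≢0⇒n<m {q} {p} (>⇒≢ (<-trans z<s long))))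
      end≡q : toℕ (F.fromℕ (q ∸ p)) + p ≡ q
      end≡q = trans (cong (_+ p) (FP.toℕ-fromℕ (q ∸ p))) L+p≡q
      floor′ : ∀ t → c ≤ δ (segment (q ∸ p) p t)
      floor′ t = floor (toℕ t + p) (m≤n+m p (toℕ t))
        (≤-trans (+-monoˡ-≤ p (≤-pred (FP.toℕ<n t))) (≤-reflexive L+p≡q))
      refute : (∃ λ k → 0 < toℕ k × toℕ k < q ∸ p × δ (segment (q ∸ p) p k) ≡ c) → ⊥
      refute (k , 0<k , k<L , δk≡c) = <-irrefl (sym δk≡c)
        (above (toℕ k + p) (+-monoˡ-< p 0<k) (subst (toℕ k + p <_) L+p≡q (+-monoˡ-< p k<L)))

    far-from-subpath : ∀ {a b eQ t} → IsSetDist G x (SubPathSet G P a b) eQ →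
      toℕ a ≤ t → t ≤ toℕ b → eQ ≤ δ (along t)
    far-from-subpath {a} {b} {t = t} dist-Q a≤t t≤b =
      proj₂ dist-Q (along t) _ (clamp l t , a≤clamp , clamp≤b , refl) (δ-dist _)
      where
      t≡ : toℕ (clamp l t) ≡ t
      t≡ = toℕ-clamp (≤-trans t≤b (FP.toℕ≤pred[n] b))
      a≤clamp : toℕ a ≤ toℕ (clamp l t)
      a≤clamp = subst (toℕ a ≤_) (sym t≡) a≤t
      clamp≤b : toℕ (clamp l t) ≤ toℕ b
      clamp≤b = subst (_≤ toℕ b) (sym t≡) t≤b

    PGAtMost⇒¬far-stretch : ∀ {γ c i A B j} → PGAtMost G γ →
      i < A → A ≤ B → B < j → j ≤ l → γ ≤ B ∸ A →
      δ (along i) ≤ c → δ (along j) ≤ c → (∀ t → A ≤ t → t ≤ B → c < δ (along t)) → ⊥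
    PGAtMost⇒¬far-stretch pg i<A A≤B B<j j≤l γ≤B∸A δi≤c δj≤c far
      with hump-around along-lipschitz i<A A≤B B<j δi≤c δj≤c far
    ... | p , q , p<A , B<q , q≤j , hump = PGAtMost⇒¬long-hump pg hump (≤-trans q≤j j≤l)
      (≤-trans (s≤s (s≤s γ≤B∸A)) (2+[n∸m]≤o∸k p<A A≤B B<q))

lemma7 : (G : Graph) → Connected G → (γ : ℕ) → PG≡ G γ →
    (l : ℕ) (P : Fin (suc l) → Graph.V G) → IsShortestPath G P →
    (s : Graph.V G) → P fzero ≡ s →
    (a b : Fin (suc l)) → a F.≤ b → γ < suc (toℕ b ∸ toℕ a) →
    (u w : Graph.V G) →
    PathSet G P u → ¬ SubPathSet G P a b u →
    PathSet G P w → ¬ SubPathSet G P a b w →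
    (du dQ dw : ℕ) → IsDist G s u du → IsSetDist G s (SubPathSet G P a b) dQ →
    IsDist G s w dw → du < dQ → dQ < dw →
    (x : Graph.V G) (ex eQ ew : ℕ) →
    IsDist G x u ex → IsSetDist G x (SubPathSet G P a b) eQ → IsDist G x w ew →
    ex < eQ → eQ ≤ ew
lemma7 G conn _ (pg , _) _ P sp _ refl a b a≤b gap _ _ (i , refl) _ (j , refl) w∉Q
  _ dQ _ du-dist dQ-dist dw-dist du<dQ dQ<dw x ex eQ ew ex-dist eQ-dist ew-dist ex<eQ =
  decidable-stable (eQ ≤? ew) λ eQ≰ew → ¬¬-distances conn x λ dists →
    stretch-refuted (proj₂ ∘ dists) (⊔-lub ex<eQ (≰⇒> eQ≰ew))
  where
  open Along G sp

  -- d(s,u) < d(s,Q) alone places u before Q.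
  i<a : toℕ i < toℕ a
  i<a = subst (_< toℕ a) (IsDist-unique du-dist (proj₂ sp i))
    (<-≤-trans du<dQ (proj₂ dQ-dist (P a) _ (a , ≤-refl , a≤b , refl) (proj₂ sp a)))

  b<j : toℕ b < toℕ j
  b<j = beyond-subpath dQ-dist (subst (dQ <_) (IsDist-unique dw-dist (proj₂ sp j)) dQ<dw) w∉Q

  stretch-refuted : ∀ {δ} → (∀ v → IsDist G x v (δ v)) → ex ⊔ ew < eQ → ⊥
  stretch-refuted {δ} δ-dist c<eQ =
    PGAtMost⇒¬far-stretch δ-dist pg i<a a≤b b<j (FP.toℕ≤pred[n] j) (≤-pred gap)
      (≤-trans (≤-reflexive (δ-at i ex-dist)) (m≤m⊔n ex ew))
      (≤-trans (≤-reflexive (δ-at j ew-dist)) (m≤n⊔m ex ew))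
      (λ t a≤t t≤b → <-≤-trans c<eQ (far-from-subpath δ-dist eQ-dist a≤t t≤b))
    where
    δ-at : ∀ k {e} → IsDist G x (P k) e → δ (along (toℕ k)) ≡ e
    δ-at k dist-k = trans (cong δ (along-toℕ k)) (IsDist-unique (δ-dist (P k)) dist-k)
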